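{- Let $q$ be a prime power, let $k:=(q-1)N+1$ for some integer $N\ge 0$, and let $\gamma\in\mathbb{F}_{q^2}^*$. Then $F(X):=X+\gamma\,\mathrm{Tr}_{q^2/q}(X^k)$ permutes $\mathbb{F}_{q^2}$ if and only if \[H(X):=\frac{X^N+\gamma^q(1+X^{2N-1})}{X^{N-1}+\gamma(X^{2N-1}+1)}\] permutes the set $\mu_{q+1}$ of $(q+1)$-th roots of unity in $\mathbb{F}_{q^2}^*$, or equivalently, if and only if this rational function is injective on $\mu_{q+1}$ and its denominator has no roots in $\mu_{q+1}$.
   Context: $\mathrm{Tr}_{q^2/q}(X)$ denotes the polynomial $X^q+X$. A polynomial permutes $\mathbb{F}_{q^2}$ if the map it induces on $\mathbb{F}_{q^2}$ is bijective. -}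

module Defs where

open import Level using (0ℓ)
open import Data.Nat using (ℕ; zero; suc; _≥_)
import Data.Nat as ℕ
open import Data.Nat.Primality using (Prime)
open import Data.Integer using (ℤ; +_; -[1+_])
open import Data.Product using (Σ; _×_; _,_)
open import Data.Fin using (Fin)
open import Relation.Binary.PropositionalEquality using (_≡_; _≢_)
open import Relation.Nullary using (¬_)
open import Algebra.Core using (Op₁; Op₂)
open import Function.Bundles using (_↔_)
open import Function.Definitions using (Bijective)
import Algebra.Structures as AS

IsPrimePower : ℕ → Set
IsPrimePower q = Σ ℕ λ p → Σ ℕ λ e → Prime p × e ≥ 1 × q ≡ p ℕ.^ e

-- A field (with propositional equality).  The inverse is a total operation
-- whose value at 0 is irrelevant; it is only required to invert nonzero elements.
record Field : Set₁ where
  infixl 6 _+_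
  infixl 7 _*_
  field
    Carrier : Set
    _+_ _*_ : Op₂ Carrier
    -_      : Op₁ Carrier
    0# 1#   : Carrier
    _⁻¹     : Op₁ Carrier
    isCommutativeRing : AS.IsCommutativeRing {A = Carrier} _≡_ _+_ _*_ -_ 0# 1#
    0≢1     : 0# ≢ 1#
    ⁻¹-inverse : ∀ x → x ≢ 0# → x * (x ⁻¹) ≡ 1#

record FiniteFieldOfSize (n : ℕ) : Set₁ where
  field
    field′ : Field
  open Field field′ public
  field
    enumeration : Fin n ↔ Carrier

module FieldOps (K : Field) where
  open Field K

  _^_ : Carrier → ℕ → Carrier
  x ^ zero  = 1#
  x ^ suc n = x * (x ^ n)

  -- integer powers (meaningful for x ≠ 0; x ^ℤ -[1+ n] = (x⁻¹)^(n+1))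
  _^ℤ_ : Carrier → ℤ → Carrier
  x ^ℤ (+ n)     = x ^ n
  x ^ℤ -[1+ n ]  = (x ⁻¹) ^ suc n

  Permutes : (Carrier → Carrier) → Set
  Permutes f = Bijective _≡_ _≡_ f

  μ : ℕ → Carrier → Set
  μ m x = x ^ m ≡ 1#

  PermutesSubset : (Carrier → Set) → (Carrier → Carrier) → Set
  PermutesSubset S h =
    (∀ x → S x → S (h x)) ×
    (∀ x y → S x → S y → h x ≡ h y → x ≡ y) ×
    (∀ y → S y → Σ Carrier λ x → S x × h x ≡ y)

  InjectiveOn : (Carrier → Set) → (Carrier → Carrier) → Set
  InjectiveOn S h = ∀ x y → S x → S y → h x ≡ h y → x ≡ y

  RationalPermutes : (Carrier → Set) → (num den : Carrier → Carrier) → Set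
  RationalPermutes S num den =
    (∀ x → S x → den x ≢ 0#) × PermutesSubset S (λ x → num x * (den x ⁻¹))

  RationalInjectiveNoPoles : (Carrier → Set) → (num den : Carrier → Carrier) → Set
  RationalInjectiveNoPoles S num den =
    InjectiveOn S (λ x → num x * (den x ⁻¹)) × (∀ x → S x → den x ≢ 0#)

{-# OPTIONS --safe #-}
-- For x ≠ 0 put y = x^(q-1); by Hilbert 90 these y are exactly the elements of μ₍q+1₎, and
-- x^k = y^N x. Clearing denominators gives y^N F(x) = x·y·den(y) and y^N F(x)^q = x·y·num(y),
-- hence H(x^(q-1)) = F(x)^(q-1): raising to the power q-1 carries F to H. If F permutes, den has
-- no zero on μ₍q+1₎ (otherwise F(x) = 0 = F(0)), and H permutes μ₍q+1₎; for injectivity, two x with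
-- the same F(x)^(q-1) differ by a factor c with c^q = c, and F(c x) = c F(x). Conversely, if H is
-- injective on μ₍q+1₎ without poles there, F(a) = F(b) forces a^(q-1) = b^(q-1) and then a = b,
-- and an injective self-map of a finite field is onto.
module Submission where

open import Defs
open import Level using (0ℓ)
open import Data.Nat as ℕ using (ℕ; zero; suc; _≤_; _<_; _∸_; z≤n; s≤s; _!)
import Data.Nat.Properties as ℕₚ
open import Data.Nat.Divisibility using (_∣_; divides; ∣1⇒≡1; ∣⇒≤; m∣m*n)
open import Data.Nat.DivMod using (m*[n/m]≡n)
open import Data.Nat.Primality using (Prime; ¬prime[0]; ¬prime[1]; euclidsLemma)
open import Data.Nat.Combinatorics using (_C_; nCn≡1; k![n∸k]!∣n!)
open import Data.Nat.Combinatorics.Specification using (nCk≡n!/k![n-k]!)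
open import Data.Integer as ℤ using (+_)
open import Data.Product using (∃; _×_; _,_; proj₁; proj₂)
open import Data.Sum using (inj₁; inj₂)
open import Data.Empty using (⊥-elim)
open import Relation.Nullary using (¬_; ¬?; Dec; yes; no)
open import Relation.Nullary.Decidable using (decidable-stable)
open import Relation.Binary.PropositionalEquality
open import Relation.Binary.Definitions using (DecidableEquality)
open import Data.Vec using (Vec; []; _∷_; replicate)
open import Data.Fin as Fin using (Fin; zero; suc; inject₁; fromℕ)
import Data.Fin.Properties as Finₚ
open import Function.Definitions using (Injective; Surjective)
open import Function using (_∘_)
open import Function.Bundles using (Inverse; Injection; _↔_; mk↔ₛ′; _⇔_; mk⇔)
open import Function.Properties.Inverse using (↔-sym; ↔-trans; ↔⇒↣)
open import Algebra.Bundles using (CommutativeMonoid; CommutativeRing)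
import Algebra.Properties.CommutativeMonoid.Sum as CommutativeMonoidSum
import Algebra.Properties.Group as GroupProperties

module FieldProperties (K : Field) where
  open Field K public
  open FieldOps K public
  open ≡-Reasoning

  commutativeRing : CommutativeRing 0ℓ 0ℓ
  commutativeRing = record { isCommutativeRing = isCommutativeRing }

  open CommutativeRing commutativeRing public
    using ( +-comm; +-identityˡ; +-identityʳ; -‿inverseˡ
          ; *-assoc; *-comm; *-identityˡ; *-identityʳ; distribˡ; distribʳ; zeroˡ; zeroʳ
          ; +-group; +-commutativeMonoid; *-commutativeMonoid; semiring; commutativeSemiring )
  open GroupProperties +-group public
    using (identityʳ-unique; //-rightDividesˡ; //-rightDividesʳ)
    renaming (∙-cancelʳ to +-cancelʳ)
  open import Algebra.Properties.Semiring.Mult semiring public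
    using (×-assoc-*; ×1-homo-*) renaming (_×_ to _·_)
  open import Algebra.Solver.Ring.NaturalCoefficients.Default commutativeSemiring public
    using (solve; _:=_; _:+_; _:*_)

  m·x≡m·1*x : ∀ m x → m · x ≡ m · 1# * x
  m·x≡m·1*x m x = begin
    m · x        ≡⟨ cong (m ·_) (*-identityˡ x) ⟨
    m · (1# * x) ≡⟨ ×-assoc-* m 1# x ⟨
    m · 1# * x   ∎

  ^-homo-* : ∀ x m n → x ^ (m ℕ.+ n) ≡ x ^ m * x ^ n
  ^-homo-* x zero    n = sym (*-identityˡ _)
  ^-homo-* x (suc m) n = trans (cong (x *_) (^-homo-* x m n)) (sym (*-assoc x _ _))

  ^-distrib-* : ∀ x y n → (x * y) ^ n ≡ x ^ n * y ^ n
  ^-distrib-* x y zero    = sym (*-identityˡ 1#)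
  ^-distrib-* x y (suc n) = trans (cong ((x * y) *_) (^-distrib-* x y n))
    (solve 4 (λ a b c d → ((a :* b) :* (c :* d)) := ((a :* c) :* (b :* d))) refl x y (x ^ n) (y ^ n))

  ^-*-assoc : ∀ x m n → (x ^ m) ^ n ≡ x ^ (m ℕ.* n)
  ^-*-assoc x m zero    = cong (x ^_) (sym (ℕₚ.*-zeroʳ m))
  ^-*-assoc x m (suc n) = begin
    x ^ m * (x ^ m) ^ n     ≡⟨ cong (x ^ m *_) (^-*-assoc x m n) ⟩
    x ^ m * x ^ (m ℕ.* n)   ≡⟨ ^-homo-* x m (m ℕ.* n) ⟨
    x ^ (m ℕ.+ m ℕ.* n)     ≡⟨ cong (x ^_) (ℕₚ.*-suc m n) ⟨
    x ^ (m ℕ.* suc n)       ∎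

  ^-comm : ∀ x m n → (x ^ m) ^ n ≡ (x ^ n) ^ m
  ^-comm x m n = begin
    (x ^ m) ^ n   ≡⟨ ^-*-assoc x m n ⟩
    x ^ (m ℕ.* n) ≡⟨ cong (x ^_) (ℕₚ.*-comm m n) ⟩
    x ^ (n ℕ.* m) ≡⟨ ^-*-assoc x n m ⟨
    (x ^ n) ^ m   ∎

  1^n≡1 : ∀ n → 1# ^ n ≡ 1#
  1^n≡1 zero    = refl
  1^n≡1 (suc n) = trans (cong (1# *_) (1^n≡1 n)) (*-identityˡ 1#)

  1≢0 : 1# ≢ 0#
  1≢0 1≡0 = 0≢1 (sym 1≡0)

  x⁻¹*[x*y]≡y : ∀ {x} y → x ≢ 0# → x ⁻¹ * (x * y) ≡ y
  x⁻¹*[x*y]≡y {x} y x≢0 = begin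
    x ⁻¹ * (x * y) ≡⟨ *-assoc (x ⁻¹) x y ⟨
    x ⁻¹ * x * y   ≡⟨ cong (_* y) (trans (*-comm (x ⁻¹) x) (⁻¹-inverse x x≢0)) ⟩
    1# * y         ≡⟨ *-identityˡ y ⟩
    y              ∎

  x*[x⁻¹*y]≡y : ∀ {x} y → x ≢ 0# → x * (x ⁻¹ * y) ≡ y
  x*[x⁻¹*y]≡y {x} y x≢0 = begin
    x * (x ⁻¹ * y) ≡⟨ *-assoc x (x ⁻¹) y ⟨
    x * x ⁻¹ * y   ≡⟨ cong (_* y) (⁻¹-inverse x x≢0) ⟩
    1# * y         ≡⟨ *-identityˡ y ⟩
    y              ∎

  x*y⁻¹*y≡x : ∀ x {y} → y ≢ 0# → x * y ⁻¹ * y ≡ x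
  x*y⁻¹*y≡x x {y} y≢0 = begin
    x * y ⁻¹ * y   ≡⟨ *-assoc x (y ⁻¹) y ⟩
    x * (y ⁻¹ * y) ≡⟨ cong (x *_) (trans (*-comm (y ⁻¹) y) (⁻¹-inverse y y≢0)) ⟩
    x * 1#         ≡⟨ *-identityʳ x ⟩
    x              ∎

  *-cancelˡ : ∀ {x y z} → x ≢ 0# → x * y ≡ x * z → y ≡ z
  *-cancelˡ {x} {y} {z} x≢0 eq = begin
    y              ≡⟨ x⁻¹*[x*y]≡y y x≢0 ⟨
    x ⁻¹ * (x * y) ≡⟨ cong (x ⁻¹ *_) eq ⟩
    x ⁻¹ * (x * z) ≡⟨ x⁻¹*[x*y]≡y z x≢0 ⟩
    z              ∎

  *-cancelʳ : ∀ {x y z} → x ≢ 0# → y * x ≡ z * x → y ≡ z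
  *-cancelʳ {x} {y} {z} x≢0 eq = *-cancelˡ x≢0 (trans (*-comm x y) (trans eq (*-comm z x)))

  x*y≢0 : ∀ {x y} → x ≢ 0# → y ≢ 0# → x * y ≢ 0#
  x*y≢0 {x} x≢0 y≢0 xy≡0 = y≢0 (*-cancelˡ x≢0 (trans xy≡0 (sym (zeroʳ x))))

  x^n≢0 : ∀ {x} n → x ≢ 0# → x ^ n ≢ 0#
  x^n≢0 zero    x≢0 = 1≢0
  x^n≢0 (suc n) x≢0 = x*y≢0 x≢0 (x^n≢0 n x≢0)

  m^e·1≡[m·1]^e : ∀ m e → (m ℕ.^ e) · 1# ≡ (m · 1#) ^ e
  m^e·1≡[m·1]^e m zero    = +-identityʳ 1#
  m^e·1≡[m·1]^e m (suc e) = trans (×1-homo-* m (m ℕ.^ e)) (cong (m · 1# *_) (m^e·1≡[m·1]^e m e))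

  0^n≡0 : ∀ {n} → 1 ≤ n → 0# ^ n ≡ 0#
  0^n≡0 (s≤s _) = zeroˡ _

  x^n≡y^n⇒[x*y⁻¹]^n≡1 : ∀ {x y} n → y ≢ 0# → x ^ n ≡ y ^ n → (x * y ⁻¹) ^ n ≡ 1#
  x^n≡y^n⇒[x*y⁻¹]^n≡1 {x} {y} n y≢0 eq = *-cancelʳ (x^n≢0 n y≢0) (begin
    (x * y ⁻¹) ^ n * y ^ n ≡⟨ ^-distrib-* (x * y ⁻¹) y n ⟨
    (x * y ⁻¹ * y) ^ n     ≡⟨ cong (_^ n) (x*y⁻¹*y≡x x y≢0) ⟩
    x ^ n                  ≡⟨ eq ⟩
    y ^ n                  ≡⟨ *-identityˡ (y ^ n) ⟨
    1# * y ^ n             ∎)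

  y*y^ℤ[n-1]≡y^n : ∀ {y} n → y ≢ 0# → y * y ^ℤ (+ n ℤ.- + 1) ≡ y ^ n
  y*y^ℤ[n-1]≡y^n {y} zero    y≢0 = trans (cong (y *_) (*-identityʳ (y ⁻¹))) (⁻¹-inverse y y≢0)
  y*y^ℤ[n-1]≡y^n {y} (suc n) y≢0 = refl

  y*y^ℤ[2n-1]≡y^n*y^n : ∀ {y} n → y ≢ 0# → y * y ^ℤ (+ (2 ℕ.* n) ℤ.- + 1) ≡ y ^ n * y ^ n
  y*y^ℤ[2n-1]≡y^n*y^n {y} n y≢0 = begin
    y * y ^ℤ (+ (2 ℕ.* n) ℤ.- + 1) ≡⟨ y*y^ℤ[n-1]≡y^n (2 ℕ.* n) y≢0 ⟩
    y ^ (n ℕ.+ (n ℕ.+ 0))          ≡⟨ cong (λ m → y ^ (n ℕ.+ m)) (ℕₚ.+-identityʳ n) ⟩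
    y ^ (n ℕ.+ n)                  ≡⟨ ^-homo-* y n n ⟩
    y ^ n * y ^ n                  ∎

module MonicPolynomials (K : Field) (_≟_ : DecidableEquality (Field.Carrier K)) where
  open FieldProperties K
  open ≡-Reasoning

  -- c₀ ∷ c₁ ∷ ⋯ ∷ c₍d-1₎ ∷ [] stands for c₀ + c₁ X + ⋯ + c₍d-1₎ X^(d-1) + X^d.
  Monic : ℕ → Set
  Monic = Vec Carrier

  eval : ∀ {d} → Monic d → Carrier → Carrier
  eval []       x = 1#
  eval (c ∷ cs) x = c + x * eval cs x

  addScaled : ∀ {d} → Monic (suc d) → Monic d → Carrier → Monic (suc d)
  addScaled (a ∷ [])       []       r = a + r ∷ []
  addScaled (a ∷ a′ ∷ as) (b ∷ bs) r = a + r * b ∷ addScaled (a′ ∷ as) bs r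

  eval-addScaled : ∀ {d} (P : Monic (suc d)) Q r x →
                   eval (addScaled P Q r) x ≡ eval P x + r * eval Q x
  eval-addScaled (a ∷ []) [] r x = begin
    a + r + x * 1#       ≡⟨ solve 4 (λ a r x o → (a :+ r :+ x :* o) := (a :+ x :* o :+ r)) refl a r x 1# ⟩
    a + x * 1# + r       ≡⟨ cong (λ e → a + x * 1# + e) (*-identityʳ r) ⟨
    a + x * 1# + r * 1#  ∎
  eval-addScaled (a ∷ a′ ∷ as) (b ∷ bs) r x = begin
    a + r * b + x * eval (addScaled (a′ ∷ as) bs r) x
      ≡⟨ cong (λ e → a + r * b + x * e) (eval-addScaled (a′ ∷ as) bs r x) ⟩
    a + r * b + x * (A + r * B)
      ≡⟨ solve 6 (λ a b r x A B → (a :+ r :* b :+ x :* (A :+ r :* B)) := (a :+ x :* A :+ r :* (b :+ x :* B)))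
               refl a b r x A B ⟩
    a + x * A + r * (b + x * B)
      ∎
    where A = eval (a′ ∷ as) x
          B = eval bs x

  quotient : ∀ {d} → Monic (suc d) → Carrier → Monic d
  quotient (c ∷ [])      r = []
  quotient (c ∷ c′ ∷ cs) r = addScaled (c′ ∷ cs) (quotient (c′ ∷ cs) r) r

  -- P(x) - P(r) = (x - r) Q(x), with both sides moved so that no subtraction occurs.
  eval-quotient : ∀ {d} (P : Monic (suc d)) r x →
                  eval P x + r * eval (quotient P r) x ≡ x * eval (quotient P r) x + eval P r
  eval-quotient (c ∷ []) r x = begin
    c + x * 1# + r * 1#   ≡⟨ solve 4 (λ c r x o → (c :+ x :* o :+ r :* o) := (x :* o :+ (c :+ r :* o))) refl c r x 1# ⟩
    x * 1# + (c + r * 1#) ∎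
  eval-quotient (c ∷ P@(c′ ∷ cs)) r x = begin
    c + x * A + r * eval (addScaled P (quotient P r) r) x ≡⟨ cong (λ e → c + x * A + r * e) (eval-addScaled P _ r x) ⟩
    c + x * A + r * (A + r * Q)                           ≡⟨ cong (λ e → c + x * A + r * e) (eval-quotient P r x) ⟩
    c + x * A + r * (x * Q + B)
      ≡⟨ solve 6 (λ c x A r Q B → (c :+ x :* A :+ r :* (x :* Q :+ B)) := (x :* (A :+ r :* Q) :+ (c :+ r :* B)))
               refl c x A r Q B ⟩
    x * (A + r * Q) + (c + r * B)                         ≡⟨ cong (λ e → x * e + (c + r * B)) (eval-addScaled P _ r x) ⟨
    x * eval (addScaled P (quotient P r) r) x + (c + r * B) ∎
    where A = eval P x
          Q = eval (quotient P r) x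
          B = eval P r

  quotient-root : ∀ {d} (P : Monic (suc d)) {r s} → eval P r ≡ 0# → eval P s ≡ 0# → r ≢ s →
                  eval (quotient P r) s ≡ 0#
  quotient-root P {r} {s} Pr≡0 Ps≡0 r≢s with eval (quotient P r) s ≟ 0#
  ... | yes Qs≡0 = Qs≡0
  ... | no  Qs≢0 = ⊥-elim (r≢s (*-cancelʳ Qs≢0 (begin
    r * Q             ≡⟨ +-identityˡ (r * Q) ⟨
    0# + r * Q        ≡⟨ cong (_+ r * Q) Ps≡0 ⟨
    eval P s + r * Q  ≡⟨ eval-quotient P r s ⟩
    s * Q + eval P r  ≡⟨ cong (λ e → s * Q + e) Pr≡0 ⟩
    s * Q + 0#        ≡⟨ +-identityʳ (s * Q) ⟩
    s * Q             ∎)))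
    where Q = eval (quotient P r) s

  roots≤degree : ∀ {d m} (P : Monic d) (r : Fin m → Carrier) → Injective _≡_ _≡_ r →
                 (∀ i → eval P (r i) ≡ 0#) → m ≤ d
  roots≤degree {m = zero}      P  r r-inj roots = z≤n
  roots≤degree {zero} {suc m}  [] r r-inj roots = ⊥-elim (1≢0 (roots zero))
  roots≤degree {suc d} {suc m} P  r r-inj roots =
    s≤s (roots≤degree (quotient P (r zero)) (r ∘ suc) (Finₚ.suc-injective ∘ r-inj)
          (λ i → quotient-root P (roots zero) (roots (suc i)) (Finₚ.0≢1+n ∘ r-inj)))

  X^ : ∀ d → Monic d
  X^ d = replicate d 0#

  eval-X^ : ∀ d x → eval (X^ d) x ≡ x ^ d
  eval-X^ zero    x = refl
  eval-X^ (suc d) x = trans (+-identityˡ _) (cong (x *_) (eval-X^ d x))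

  X^[2+d]-X : ∀ d → Monic (2 ℕ.+ d)
  X^[2+d]-X d = 0# ∷ - 1# ∷ X^ d

  X^[2+d]-X-root : ∀ d {x} → x ^ (2 ℕ.+ d) ≡ x → eval (X^[2+d]-X d) x ≡ 0#
  X^[2+d]-X-root d {x} fixed = begin
    0# + x * (- 1# + x * eval (X^ d) x)  ≡⟨ +-identityˡ _ ⟩
    x * (- 1# + x * eval (X^ d) x)       ≡⟨ cong (λ e → x * (- 1# + x * e)) (eval-X^ d x) ⟩
    x * (- 1# + x ^ suc d)               ≡⟨ distribˡ x (- 1#) (x ^ suc d) ⟩
    x * - 1# + x ^ (2 ℕ.+ d)             ≡⟨ cong (λ e → x * - 1# + e) (trans fixed (sym (*-identityʳ x))) ⟩
    x * - 1# + x * 1#                    ≡⟨ distribˡ x (- 1#) 1# ⟨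
    x * (- 1# + 1#)                      ≡⟨ cong (x *_) (-‿inverseˡ 1#) ⟩
    x * 0#                               ≡⟨ zeroʳ x ⟩
    0#                                   ∎

p∤m! : ∀ {p} → Prime p → ∀ m → m < p → ¬ p ∣ m !
p∤m! p-prime zero    _   p∣1       = ¬prime[1] (subst Prime (∣1⇒≡1 p∣1) p-prime)
p∤m! p-prime (suc m) m<p p∣[1+m]! with euclidsLemma (suc m) (m !) p-prime p∣[1+m]!
... | inj₁ p∣1+m = ℕₚ.<⇒≱ m<p (∣⇒≤ p∣1+m)
... | inj₂ p∣m!  = p∤m! p-prime m (ℕₚ.<-trans (ℕₚ.n<1+n m) m<p) p∣m!

p∣pCk : ∀ {p k} → Prime p → 0 < k → k < p → p ∣ p C k
p∣pCk {p} {k} p-prime 0<k k<p with euclidsLemma (k ! ℕ.* (p ∸ k) !) (p C k) p-prime p∣k![p∸k]!*pCk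
  where
  instance _ = k ℕₚ.!* (p ∸ k) !≢0
  k![p∸k]!*pCk≡p! : k ! ℕ.* (p ∸ k) ! ℕ.* (p C k) ≡ p !
  k![p∸k]!*pCk≡p! = trans (cong (k ! ℕ.* (p ∸ k) ! ℕ.*_) (nCk≡n!/k![n-k]! (ℕₚ.<⇒≤ k<p)))
                          (m*[n/m]≡n (k![n∸k]!∣n! (ℕₚ.<⇒≤ k<p)))
  p∣p! : ∀ {p} → 0 < p → p ∣ p !
  p∣p! {suc p} _ = m∣m*n (p !)
  p∣k![p∸k]!*pCk : p ∣ k ! ℕ.* (p ∸ k) ! ℕ.* (p C k)
  p∣k![p∸k]!*pCk = subst (p ∣_) (sym k![p∸k]!*pCk≡p!) (p∣p! (ℕₚ.<-trans 0<k k<p))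
... | inj₂ p∣pCk = p∣pCk
... | inj₁ p∣k![p∸k]! with euclidsLemma (k !) ((p ∸ k) !) p-prime p∣k![p∸k]!
...   | inj₁ p∣k!     = ⊥-elim (p∤m! p-prime k k<p p∣k!)
...   | inj₂ p∣[p∸k]! = ⊥-elim (p∤m! p-prime (p ∸ k) (ℕₚ.∸-monoʳ-< 0<k (ℕₚ.<⇒≤ k<p)) p∣[p∸k]!)

module Frobenius (K : Field) where
  open FieldProperties K
  open ≡-Reasoning
  import Algebra.Properties.Semiring.Exp semiring as Exp
  import Algebra.Properties.CommutativeSemiring.Binomial commutativeSemiring as Binomial
  open import Algebra.Properties.Monoid.Sum (CommutativeRing.+-monoid commutativeRing)
    using (sum; sum-init-last; sum-cong-≗; sum-replicate-zero)

  ^≡Exp^ : ∀ x n → x ^ n ≡ x Exp.^ n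
  ^≡Exp^ x zero    = refl
  ^≡Exp^ x (suc n) = cong (x *_) (^≡Exp^ x n)

  sum-first-last : ∀ {m} (t : Fin (2 ℕ.+ m) → Carrier) → (∀ j → t (suc (inject₁ j)) ≡ 0#) →
                   sum t ≡ t zero + t (fromℕ (suc m))
  sum-first-last {m} t inner≡0 = cong (λ s → t zero + s) (begin
    sum (t ∘ suc)                                        ≡⟨ sum-init-last (t ∘ suc) ⟩
    sum (t ∘ suc ∘ inject₁) + t (fromℕ (suc m))          ≡⟨ cong (_+ t (fromℕ (suc m))) (sum-cong-≗ inner≡0) ⟩
    sum {m} (λ _ → 0#) + t (fromℕ (suc m))               ≡⟨ cong (_+ t (fromℕ (suc m))) (sum-replicate-zero m) ⟩
    0# + t (fromℕ (suc m))                               ≡⟨ +-identityˡ _ ⟩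
    t (fromℕ (suc m))                                    ∎)

  p∣m⇒m·x≡0 : ∀ {p m} → p · 1# ≡ 0# → ∀ x → p ∣ m → m · x ≡ 0#
  p∣m⇒m·x≡0 {p} p·1≡0 x (divides c refl) = begin
    (c ℕ.* p) · x            ≡⟨ m·x≡m·1*x (c ℕ.* p) x ⟩
    (c ℕ.* p) · 1# * x       ≡⟨ cong (_* x) (×1-homo-* c p) ⟩
    c · 1# * (p · 1#) * x    ≡⟨ cong (λ e → c · 1# * e * x) p·1≡0 ⟩
    c · 1# * 0# * x          ≡⟨ cong (_* x) (zeroʳ (c · 1#)) ⟩
    0# * x                   ≡⟨ zeroˡ x ⟩
    0#                       ∎

  frobenius : ∀ {p} → Prime p → p · 1# ≡ 0# → ∀ x y → (x + y) ^ p ≡ x ^ p + y ^ p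
  frobenius {0} p-prime = ⊥-elim (¬prime[0] p-prime)
  frobenius {1} p-prime = ⊥-elim (¬prime[1] p-prime)
  frobenius {p@(suc (suc r))} p-prime p·1≡0 x y = begin
    (x + y) ^ p                       ≡⟨ ^≡Exp^ (x + y) p ⟩
    (x + y) Exp.^ p                   ≡⟨ Binomial.theorem p x y ⟩
    Binomial.binomialExpansion x y p  ≡⟨ sum-first-last term inner≡0 ⟩
    term zero + term (fromℕ p)        ≡⟨ cong₂ _+_ first last ⟩
    y ^ p + x ^ p                     ≡⟨ +-comm (y ^ p) (x ^ p) ⟩
    x ^ p + y ^ p                     ∎
    where
    term : Fin (suc p) → Carrier
    term = Binomial.binomialTerm x y p
    inner≡0 : ∀ j → term (suc (inject₁ j)) ≡ 0#
    inner≡0 j = p∣m⇒m·x≡0 p·1≡0 _ (p∣pCk p-prime (s≤s z≤n)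
      (s≤s (subst (_< suc r) (sym (Finₚ.toℕ-inject₁ j)) (Finₚ.toℕ<n j))))
    first : term zero ≡ y ^ p
    first = trans (+-identityʳ _) (trans (*-identityˡ _) (sym (^≡Exp^ y p)))
    last : term (fromℕ p) ≡ x ^ p
    last rewrite Finₚ.toℕ-fromℕ r | nCn≡1 p | ℕₚ.n∸n≡0 r =
      trans (+-identityʳ _) (trans (*-identityʳ _) (sym (^≡Exp^ x p)))

  frobenius-^ : ∀ {p} → Prime p → p · 1# ≡ 0# → ∀ e x y → (x + y) ^ (p ℕ.^ e) ≡ x ^ (p ℕ.^ e) + y ^ (p ℕ.^ e)
  frobenius-^ p-prime p·1≡0 zero    x y = trans (*-identityʳ _) (sym (cong₂ _+_ (*-identityʳ x) (*-identityʳ y)))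
  frobenius-^ {p} p-prime p·1≡0 (suc e) x y = begin
    (x + y) ^ (p ℕ.* p ℕ.^ e)                  ≡⟨ ^-*-assoc (x + y) p (p ℕ.^ e) ⟨
    ((x + y) ^ p) ^ (p ℕ.^ e)                  ≡⟨ cong (_^ (p ℕ.^ e)) (frobenius p-prime p·1≡0 x y) ⟩
    (x ^ p + y ^ p) ^ (p ℕ.^ e)                ≡⟨ frobenius-^ p-prime p·1≡0 e (x ^ p) (y ^ p) ⟩
    (x ^ p) ^ (p ℕ.^ e) + (y ^ p) ^ (p ℕ.^ e)  ≡⟨ cong₂ _+_ (^-*-assoc x p (p ℕ.^ e)) (^-*-assoc y p (p ℕ.^ e)) ⟩
    x ^ (p ℕ.* p ℕ.^ e) + y ^ (p ℕ.* p ℕ.^ e)  ∎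

Fin-injective⇒surjective : ∀ {n} (f : Fin n → Fin n) → Injective _≡_ _≡_ f → Surjective _≡_ _≡_ f
Fin-injective⇒surjective {suc n} f f-inj j with Finₚ.any? (λ i → f i Finₚ.≟ j)
... | yes (i , fi≡j) = i , λ { refl → fi≡j }
... | no  ∄i         = ⊥-elim (ℕₚ.<-irrefl refl (Finₚ.injective⇒≤ punchOut-inj))
  where
  missed : ∀ i → f i ≢ j
  missed i fi≡j = ∄i (i , fi≡j)
  punchOut-inj : Injective _≡_ _≡_ (λ i → Fin.punchOut (missed i ∘ sym))
  punchOut-inj {a} {b} eq = f-inj (Finₚ.punchOut-injective (missed a ∘ sym) (missed b ∘ sym) eq)

size≥2 : ∀ {n} → FiniteFieldOfSize n → 2 ≤ n
size≥2 {zero}  K with Inverse.from (FiniteFieldOfSize.enumeration K) (FiniteFieldOfSize.0# K)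
... | ()
size≥2 {1} K = ⊥-elim (FiniteFieldOfSize.0≢1 K (begin
    0#               ≡⟨ strictlyInverseˡ 0# ⟨
    to (from 0#)     ≡⟨ cong to (Fin1-irrelevant (from 0#) (from 1#)) ⟩
    to (from 1#)     ≡⟨ strictlyInverseˡ 1# ⟩
    1#               ∎))
  where
  open FiniteFieldOfSize K
  open Inverse enumeration
  open ≡-Reasoning
  Fin1-irrelevant : (i j : Fin 1) → i ≡ j
  Fin1-irrelevant zero zero = refl
size≥2 {suc (suc n)} K = s≤s (s≤s z≤n)

module FiniteFieldProperties {n} (K : FiniteFieldOfSize n) where
  open FiniteFieldOfSize K public using (field′)
  open FiniteFieldOfSize K using (enumeration)
  open FieldProperties field′ public
  open Inverse enumeration using (to; from; strictlyInverseˡ)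
  open ≡-Reasoning

  to-injective : Injective _≡_ _≡_ to
  to-injective = Injection.injective (↔⇒↣ enumeration)

  from-injective : Injective _≡_ _≡_ from
  from-injective = Injection.injective (↔⇒↣ (↔-sym enumeration))

  infix 4 _≟_
  _≟_ : DecidableEquality Carrier
  _≟_ = Finₚ.inj⇒≟ (↔⇒↣ (↔-sym enumeration))

  injective⇒surjective : ∀ f → Injective _≡_ _≡_ f → Surjective _≡_ _≡_ f
  injective⇒surjective f f-inj y
    with i , g[i]≡from[y] ← Fin-injective⇒surjective (from ∘ f ∘ to) (to-injective ∘ f-inj ∘ from-injective) (from y)
    = to i , λ { refl → from-injective (g[i]≡from[y] refl) }

  x^m≡0⇒x≡0 : ∀ m {x} → x ^ m ≡ 0# → x ≡ 0#
  x^m≡0⇒x≡0 m {x} x^m≡0 with x ≟ 0#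
  ... | yes x≡0 = x≡0
  ... | no  x≢0 = ⊥-elim (x^n≢0 m x≢0 x^m≡0)

  module _ (M : CommutativeMonoid 0ℓ 0ℓ) where
    open CommutativeMonoid M using (_≈_; reflexive) renaming (Carrier to A; trans to ≈-trans)
    open CommutativeMonoidSum M using (sum; sum-permute; sum-cong-≗)

    sum-reindex : (t : Carrier → A) (g : Carrier ↔ Carrier) → sum (t ∘ to) ≈ sum (t ∘ Inverse.to g ∘ to)
    sum-reindex t g = ≈-trans (sum-permute (t ∘ to) π) (reflexive (sum-cong-≗ (λ i → cong t (strictlyInverseˡ (Inverse.to g (to i))))))
      where π = ↔-trans enumeration (↔-trans g (↔-sym enumeration))

  translation : Carrier → Carrier ↔ Carrier
  translation b = mk↔ₛ′ (_+ b) (λ x → x + - b) (//-rightDividesˡ b) (//-rightDividesʳ b)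

  scaling : ∀ {x} → x ≢ 0# → Carrier ↔ Carrier
  scaling {x} x≢0 = mk↔ₛ′ (x *_) (x ⁻¹ *_) (λ y → x*[x⁻¹*y]≡y y x≢0) (λ y → x⁻¹*[x*y]≡y y x≢0)

  private
    module Sum = CommutativeMonoidSum +-commutativeMonoid
    module Prod = CommutativeMonoidSum *-commutativeMonoid

  n·x≡0 : ∀ x → n · x ≡ 0#
  n·x≡0 x = identityʳ-unique (Sum.sum to) (n · x) (begin
    Sum.sum to + n · x              ≡⟨ cong (λ s → Sum.sum to + s) (Sum.sum-replicate n) ⟨
    Sum.sum to + Sum.sum {n} (λ _ → x) ≡⟨ Sum.∑-distrib-+ to (λ _ → x) ⟨
    Sum.sum (λ i → to i + x)        ≡⟨ sum-reindex +-commutativeMonoid (λ a → a) (translation x) ⟨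
    Sum.sum to                      ∎)

  prod-replicate : ∀ m x → Prod.sum {m} (λ _ → x) ≡ x ^ m
  prod-replicate zero    x = refl
  prod-replicate (suc m) x = cong (x *_) (prod-replicate m x)

  prod-single : ∀ {m} (t : Fin m → Carrier) i → (∀ j → j ≢ i → t j ≡ 1#) → Prod.sum t ≡ t i
  prod-single {suc m} t i others≡1 = begin
    Prod.sum t                            ≡⟨ Prod.sum-remove {i = i} t ⟩
    t i * Prod.sum (t ∘ Fin.punchIn i)    ≡⟨ cong (t i *_) (Prod.sum-cong-≗ (λ j → others≡1 _ (Finₚ.punchInᵢ≢i i j))) ⟩
    t i * Prod.sum {m} (λ _ → 1#)         ≡⟨ cong (t i *_) (Prod.sum-replicate-zero m) ⟩
    t i * 1#                              ≡⟨ *-identityʳ (t i) ⟩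
    t i                                   ∎

  prod≢0 : ∀ {m} (t : Fin m → Carrier) → (∀ i → t i ≢ 0#) → Prod.sum t ≢ 0#
  prod≢0 {zero}  t t≢0 = 1≢0
  prod≢0 {suc m} t t≢0 = x*y≢0 (t≢0 zero) (prod≢0 (t ∘ suc) (t≢0 ∘ suc))

  private
    unit : Carrier → Carrier
    unit a with a ≟ 0#
    ... | yes _ = 1#
    ... | no  _ = a

    unit≢0 : ∀ a → unit a ≢ 0#
    unit≢0 a with a ≟ 0#
    ... | yes _   = 1≢0
    ... | no  a≢0 = a≢0

    unit-0 : unit 0# ≡ 1#
    unit-0 with 0# ≟ 0#
    ... | yes _   = refl
    ... | no  0≢0 = ⊥-elim (0≢0 refl)

    unit-≢0 : ∀ {a} → a ≢ 0# → unit a ≡ a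
    unit-≢0 {a} a≢0 with a ≟ 0#
    ... | yes a≡0 = ⊥-elim (a≢0 a≡0)
    ... | no  _   = refl

    δ : Carrier → Carrier → Carrier
    δ x a with a ≟ 0#
    ... | yes _ = x
    ... | no  _ = 1#

    δ-0 : ∀ x → δ x 0# ≡ x
    δ-0 x with 0# ≟ 0#
    ... | yes _   = refl
    ... | no  0≢0 = ⊥-elim (0≢0 refl)

    δ-≢0 : ∀ x {a} → a ≢ 0# → δ x a ≡ 1#
    δ-≢0 x {a} a≢0 with a ≟ 0#
    ... | yes a≡0 = ⊥-elim (a≢0 a≡0)
    ... | no  _   = refl

    x*unit≡unit[x*]*δ : ∀ {x} → x ≢ 0# → ∀ a → x * unit a ≡ unit (x * a) * δ x a
    x*unit≡unit[x*]*δ {x} x≢0 a = by-cases (a ≟ 0#)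
      where
      by-cases : Dec (a ≡ 0#) → x * unit a ≡ unit (x * a) * δ x a
      by-cases (yes refl) = begin
        x * unit 0#              ≡⟨ cong (x *_) unit-0 ⟩
        x * 1#                   ≡⟨ *-comm x 1# ⟩
        1# * x                   ≡⟨ cong₂ _*_ (trans (cong unit (zeroʳ x)) unit-0) (δ-0 x) ⟨
        unit (x * 0#) * δ x 0#   ∎
      by-cases (no a≢0) = begin
        x * unit a               ≡⟨ cong (x *_) (unit-≢0 a≢0) ⟩
        x * a                    ≡⟨ *-identityʳ (x * a) ⟨
        x * a * 1#               ≡⟨ cong₂ _*_ (unit-≢0 (x*y≢0 x≢0 a≢0)) (δ-≢0 x a≢0) ⟨
        unit (x * a) * δ x a     ∎

  -- P = ∏ₐ unit a is invariant under a ↦ x a; comparing the products factorwise gives x ^ n P = P x,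
  -- where δ x absorbs the single discrepancy at a = 0.
  x^n≡x : ∀ x → x ^ n ≡ x
  x^n≡x x with x ≟ 0#
  ... | yes refl = 0^n≡0 (ℕₚ.<⇒≤ (size≥2 K))
  ... | no  x≢0  = *-cancelʳ P≢0 (begin
    x ^ n * P                                          ≡⟨ cong (_* P) (prod-replicate n x) ⟨
    Prod.sum {n} (λ _ → x) * P                         ≡⟨ Prod.∑-distrib-+ (λ _ → x) (unit ∘ to) ⟨
    Prod.sum (λ i → x * unit (to i))                   ≡⟨ Prod.sum-cong-≗ (λ i → x*unit≡unit[x*]*δ x≢0 (to i)) ⟩
    Prod.sum (λ i → unit (x * to i) * δ x (to i))      ≡⟨ Prod.∑-distrib-+ (unit ∘ (x *_) ∘ to) (δ x ∘ to) ⟩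
    Prod.sum (unit ∘ (x *_) ∘ to) * Prod.sum (δ x ∘ to) ≡⟨ cong₂ _*_ (sum-reindex *-commutativeMonoid unit (scaling x≢0)) (sym prod-δ≡x) ⟨
    P * x                                              ≡⟨ *-comm P x ⟩
    x * P                                              ∎)
    where
    P : Carrier
    P = Prod.sum (unit ∘ to)
    P≢0 : P ≢ 0#
    P≢0 = prod≢0 (unit ∘ to) (unit≢0 ∘ to)
    prod-δ≡x : Prod.sum (δ x ∘ to) ≡ x
    prod-δ≡x = begin
      Prod.sum (δ x ∘ to)  ≡⟨ prod-single (δ x ∘ to) (from 0#) (λ j j≢from0 → δ-≢0 x (j≢from0 ∘ to≡0⇒≡from0)) ⟩
      δ x (to (from 0#))   ≡⟨ cong (δ x) (strictlyInverseˡ 0#) ⟩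
      δ x 0#               ≡⟨ δ-0 x ⟩
      x                    ∎
      where to≡0⇒≡from0 : ∀ {j} → to j ≡ 0# → j ≡ from 0#
            to≡0⇒≡from0 to-j≡0 = to-injective (trans to-j≡0 (sym (strictlyInverseˡ 0#)))

module QuadraticExtension (r p e : ℕ) (p-prime : Prime p) (q≡pᵉ : suc (suc r) ≡ p ℕ.^ e)
                          (K : FiniteFieldOfSize (suc (suc r) ℕ.* suc (suc r))) where
  open FiniteFieldProperties K public
  open MonicPolynomials field′ _≟_ using (X^[2+d]-X; X^[2+d]-X-root; roots≤degree)
  open Frobenius field′ using (frobenius-^)
  open Inverse (FiniteFieldOfSize.enumeration K) using (to)
  open ≡-Reasoning

  q : ℕ
  q = suc (suc r)

  p·1≡0 : p · 1# ≡ 0#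
  p·1≡0 = x^m≡0⇒x≡0 (e ℕ.+ e) (begin
    (p · 1#) ^ (e ℕ.+ e)                   ≡⟨ ^-homo-* (p · 1#) e e ⟩
    (p · 1#) ^ e * (p · 1#) ^ e            ≡⟨ cong₂ _*_ (m^e·1≡[m·1]^e p e) (m^e·1≡[m·1]^e p e) ⟨
    (p ℕ.^ e) · 1# * (p ℕ.^ e) · 1#        ≡⟨ ×1-homo-* (p ℕ.^ e) (p ℕ.^ e) ⟨
    (p ℕ.^ e ℕ.* p ℕ.^ e) · 1#             ≡⟨ cong (λ m → (m ℕ.* m) · 1#) q≡pᵉ ⟨
    (q ℕ.* q) · 1#                         ≡⟨ n·x≡0 1# ⟩
    0#                                     ∎)

  frobenius-q : ∀ x y → (x + y) ^ q ≡ x ^ q + y ^ q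
  frobenius-q x y = subst (λ m → (x + y) ^ m ≡ x ^ m + y ^ m) (sym q≡pᵉ) (frobenius-^ p-prime p·1≡0 e x y)

  [x^q]^q≡x : ∀ x → (x ^ q) ^ q ≡ x
  [x^q]^q≡x x = trans (^-*-assoc x q q) (x^n≡x x)

  x^[q-1]∈μ : ∀ {x} → x ≢ 0# → μ (suc q) (x ^ (q ∸ 1))
  x^[q-1]∈μ {x} x≢0 = *-cancelˡ x≢0 (begin
    x * (x ^ (q ∸ 1) * (x ^ (q ∸ 1)) ^ q)     ≡⟨ cong (λ e → x * (x ^ (q ∸ 1) * e)) (^-*-assoc x (q ∸ 1) q) ⟩
    x * (x ^ (q ∸ 1) * x ^ ((q ∸ 1) ℕ.* q))   ≡⟨ cong (x *_) (^-homo-* x (q ∸ 1) ((q ∸ 1) ℕ.* q)) ⟨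
    x ^ (q ℕ.* q)                             ≡⟨ x^n≡x x ⟩
    x                                         ≡⟨ *-identityʳ x ⟨
    x * 1#                                    ∎)

  ∃[a]a^q≢a : ∃ λ a → a ^ q ≢ a
  ∃[a]a^q≢a with Finₚ.any? (λ i → ¬? (to i ^ q ≟ to i))
  ... | yes (i , a^q≢a) = to i , a^q≢a
  ... | no  ∄i = ⊥-elim (ℕₚ.<⇒≱ (ℕₚ.m<m*n q q (s≤s (s≤s z≤n)))
                   (roots≤degree (X^[2+d]-X r) to to-injective (λ i → X^[2+d]-X-root r (fixed i))))
    where fixed : ∀ i → to i ^ q ≡ to i
          fixed i = decidable-stable (to i ^ q ≟ to i) (λ a^q≢a → ∄i (i , a^q≢a))

  x^q≡y*x⇒x^[q-1]≡y : ∀ {x y} → x ≢ 0# → x ^ q ≡ y * x → x ^ (q ∸ 1) ≡ y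
  x^q≡y*x⇒x^[q-1]≡y {x} {y} x≢0 x^q≡y*x = *-cancelˡ x≢0 (trans x^q≡y*x (*-comm y x))

  module _ {y} (y∈μ : μ (suc q) y) where

    private
      b : Carrier → Carrier
      b a = a + y ^ q * a ^ q

      b^q≡y*b : ∀ a → b a ^ q ≡ y * b a
      b^q≡y*b a = begin
        (a + y ^ q * a ^ q) ^ q              ≡⟨ frobenius-q a (y ^ q * a ^ q) ⟩
        a ^ q + (y ^ q * a ^ q) ^ q          ≡⟨ cong (λ c → a ^ q + c) (^-distrib-* (y ^ q) (a ^ q) q) ⟩
        a ^ q + (y ^ q) ^ q * (a ^ q) ^ q    ≡⟨ cong₂ (λ c d → a ^ q + c * d) ([x^q]^q≡x y) ([x^q]^q≡x a) ⟩
        a ^ q + y * a                        ≡⟨ +-comm (a ^ q) (y * a) ⟩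
        y * a + a ^ q                        ≡⟨ cong (λ c → y * a + c) (*-identityˡ (a ^ q)) ⟨
        y * a + 1# * a ^ q                   ≡⟨ cong (λ c → y * a + c * a ^ q) y∈μ ⟨
        y * a + y * y ^ q * a ^ q            ≡⟨ cong (λ c → y * a + c) (*-assoc y (y ^ q) (a ^ q)) ⟩
        y * a + y * (y ^ q * a ^ q)          ≡⟨ distribˡ y a (y ^ q * a ^ q) ⟨
        y * (a + y ^ q * a ^ q)              ∎

      b≡0∧b[1]≡0⇒a^q≡a : ∀ {a} → b a ≡ 0# → b 1# ≡ 0# → a ^ q ≡ a
      b≡0∧b[1]≡0⇒a^q≡a {a} b≡0 b[1]≡0 = +-cancelʳ (y ^ q * a ^ q) (a ^ q) a (begin
        a ^ q + y ^ q * a ^ q               ≡⟨ cong (λ c → c + y ^ q * a ^ q) (*-identityˡ (a ^ q)) ⟨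
        1# * a ^ q + y ^ q * a ^ q          ≡⟨ distribʳ (a ^ q) 1# (y ^ q) ⟨
        (1# + y ^ q) * a ^ q                ≡⟨ cong (λ c → (1# + c) * a ^ q) (trans (cong (y ^ q *_) (1^n≡1 q)) (*-identityʳ (y ^ q))) ⟨
        b 1# * a ^ q                        ≡⟨ cong (_* a ^ q) b[1]≡0 ⟩
        0# * a ^ q                          ≡⟨ zeroˡ (a ^ q) ⟩
        0#                                  ≡⟨ b≡0 ⟨
        a + y ^ q * a ^ q                   ∎)

    -- Hilbert 90: (b a)^(q-1) = y whenever b a ≠ 0, and b vanishes at both 1 and a only if a^q = a.
    hilbert90 : ∃ λ x → x ≢ 0# × x ^ (q ∸ 1) ≡ y
    hilbert90 with ∃[a]a^q≢a
    ... | a , a^q≢a with b a ≟ 0# | b 1# ≟ 0#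
    ...   | no b≢0   | _        = b a , b≢0 , x^q≡y*x⇒x^[q-1]≡y b≢0 (b^q≡y*b a)
    ...   | yes _    | no b≢0   = b 1# , b≢0 , x^q≡y*x⇒x^[q-1]≡y b≢0 (b^q≡y*b 1#)
    ...   | yes b≡0  | yes b[1]≡0 = ⊥-elim (a^q≢a (b≡0∧b[1]≡0⇒a^q≡a b≡0 b[1]≡0))

module Proposition (r p e : ℕ) (p-prime : Prime p) (q≡pᵉ : suc (suc r) ≡ p ℕ.^ e)
                   (K : FiniteFieldOfSize (suc (suc r) ℕ.* suc (suc r)))
                   (N : ℕ) (γ : FiniteFieldOfSize.Carrier K) where
  open QuadraticExtension r p e p-prime q≡pᵉ K
  open ≡-Reasoning

  k : ℕ
  k = (q ∸ 1) ℕ.* N ℕ.+ 1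

  F : Carrier → Carrier
  F x = x + γ * ((x ^ k) ^ q + x ^ k)

  num den H : Carrier → Carrier
  num x = x ^ℤ (+ N) + (γ ^ q) * (1# + x ^ℤ (+ (2 ℕ.* N) ℤ.- + 1))
  den x = x ^ℤ (+ N ℤ.- + 1) + γ * (x ^ℤ (+ (2 ℕ.* N) ℤ.- + 1) + 1#)
  H y = num y * den y ⁻¹

  numPoly denPoly : Carrier → Carrier
  numPoly y = y ^ N * y + γ ^ q * (y + y ^ N * y ^ N)
  denPoly y = y ^ N + γ * (y ^ N * y ^ N + y)

  y*num≡numPoly : ∀ {y} → y ≢ 0# → y * num y ≡ numPoly y
  y*num≡numPoly {y} y≢0 = begin
    y * (y ^ N + γ ^ q * (1# + Y))
      ≡⟨ solve 5 (λ y A c o Y → (y :* (A :+ c :* (o :+ Y))) := (A :* y :+ c :* (y :* o :+ y :* Y))) refl y (y ^ N) (γ ^ q) 1# Y ⟩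
    y ^ N * y + γ ^ q * (y * 1# + y * Y)
      ≡⟨ cong₂ (λ c d → y ^ N * y + γ ^ q * (c + d)) (*-identityʳ y) (y*y^ℤ[2n-1]≡y^n*y^n N y≢0) ⟩
    numPoly y ∎
    where Y = y ^ℤ (+ (2 ℕ.* N) ℤ.- + 1)

  y*den≡denPoly : ∀ {y} → y ≢ 0# → y * den y ≡ denPoly y
  y*den≡denPoly {y} y≢0 = begin
    y * (X + γ * (Y + 1#))
      ≡⟨ solve 5 (λ y X c o Y → (y :* (X :+ c :* (Y :+ o))) := (y :* X :+ c :* (y :* Y :+ y :* o))) refl y X γ 1# Y ⟩
    y * X + γ * (y * Y + y * 1#)
      ≡⟨ cong₂ (λ a c → a + γ * (c + y * 1#)) (y*y^ℤ[n-1]≡y^n N y≢0) (y*y^ℤ[2n-1]≡y^n*y^n N y≢0) ⟩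
    y ^ N + γ * (y ^ N * y ^ N + y * 1#)
      ≡⟨ cong (λ c → y ^ N + γ * (y ^ N * y ^ N + c)) (*-identityʳ y) ⟩
    denPoly y ∎
    where X = y ^ℤ (+ N ℤ.- + 1)
          Y = y ^ℤ (+ (2 ℕ.* N) ℤ.- + 1)

  x^k≡[x^[q-1]]^N*x : ∀ x → x ^ k ≡ (x ^ (q ∸ 1)) ^ N * x
  x^k≡[x^[q-1]]^N*x x = begin
    x ^ ((q ∸ 1) ℕ.* N ℕ.+ 1)     ≡⟨ ^-homo-* x ((q ∸ 1) ℕ.* N) 1 ⟩
    x ^ ((q ∸ 1) ℕ.* N) * x ^ 1   ≡⟨ cong₂ _*_ (^-*-assoc x (q ∸ 1) N) (sym (*-identityʳ x)) ⟨
    (x ^ (q ∸ 1)) ^ N * x         ∎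

  F-0 : F 0# ≡ 0#
  F-0 = begin
    0# + γ * ((0# ^ k) ^ q + 0# ^ k)  ≡⟨ cong (λ z → 0# + γ * (z ^ q + z)) (trans (x^k≡[x^[q-1]]^N*x 0#) (zeroʳ _)) ⟩
    0# + γ * (0# ^ q + 0#)            ≡⟨ cong (λ z → 0# + γ * (z + 0#)) (zeroˡ _) ⟩
    0# + γ * (0# + 0#)                ≡⟨ cong (λ z → 0# + γ * z) (+-identityʳ 0#) ⟩
    0# + γ * 0#                       ≡⟨ trans (+-identityˡ _) (zeroʳ γ) ⟩
    0#                                ∎

  [yᴺ]^q*yᴺ≡1 : ∀ {y} → μ (suc q) y → (y ^ N) ^ q * y ^ N ≡ 1#
  [yᴺ]^q*yᴺ≡1 {y} y∈μ = begin
    (y ^ N) ^ q * y ^ N   ≡⟨ cong (_* y ^ N) (^-comm y N q) ⟩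
    (y ^ q) ^ N * y ^ N   ≡⟨ ^-distrib-* (y ^ q) y N ⟨
    (y ^ q * y) ^ N       ≡⟨ cong (_^ N) (trans (*-comm (y ^ q) y) y∈μ) ⟩
    1# ^ N                ≡⟨ 1^n≡1 N ⟩
    1#                    ∎

  -- Here x ^ q unfolds to x * y, since q = 2 + r.
  yᴺ*F≡x*denPoly : ∀ {x} → x ≢ 0# → (x ^ (q ∸ 1)) ^ N * F x ≡ x * denPoly (x ^ (q ∸ 1))
  yᴺ*F≡x*denPoly {x} x≢0 = begin
    Y * (x + γ * ((x ^ k) ^ q + x ^ k))   ≡⟨ cong (λ z → Y * (x + γ * (z ^ q + z))) (x^k≡[x^[q-1]]^N*x x) ⟩
    Y * (x + γ * ((Y * x) ^ q + Y * x))   ≡⟨ cong (λ z → Y * (x + γ * (z + Y * x))) (^-distrib-* Y x q) ⟩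
    Y * (x + γ * (Y ^ q * x ^ q + Y * x))
      ≡⟨ solve 5 (λ Y x g w y → (Y :* (x :+ g :* (w :* (x :* y) :+ Y :* x))) := (x :* (Y :+ g :* (Y :* Y :+ (w :* Y) :* y))))
               refl Y x γ (Y ^ q) y ⟩
    x * (Y + γ * (Y * Y + Y ^ q * Y * y)) ≡⟨ cong (λ z → x * (Y + γ * (Y * Y + z * y))) ([yᴺ]^q*yᴺ≡1 (x^[q-1]∈μ x≢0)) ⟩
    x * (Y + γ * (Y * Y + 1# * y))        ≡⟨ cong (λ z → x * (Y + γ * (Y * Y + z))) (*-identityˡ y) ⟩
    x * denPoly y                         ∎
    where y = x ^ (q ∸ 1)
          Y = y ^ N

  denPoly^q : ∀ y → denPoly y ^ q ≡ (y ^ N) ^ q + γ ^ q * ((y ^ N) ^ q * (y ^ N) ^ q + y ^ q)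
  denPoly^q y = begin
    (Y + γ * (Y * Y + y)) ^ q              ≡⟨ frobenius-q Y (γ * (Y * Y + y)) ⟩
    Y ^ q + (γ * (Y * Y + y)) ^ q          ≡⟨ cong (λ z → Y ^ q + z) (^-distrib-* γ (Y * Y + y) q) ⟩
    Y ^ q + γ ^ q * (Y * Y + y) ^ q        ≡⟨ cong (λ z → Y ^ q + γ ^ q * z) (frobenius-q (Y * Y) y) ⟩
    Y ^ q + γ ^ q * ((Y * Y) ^ q + y ^ q)  ≡⟨ cong (λ z → Y ^ q + γ ^ q * (z + y ^ q)) (^-distrib-* Y Y q) ⟩
    Y ^ q + γ ^ q * (Y ^ q * Y ^ q + y ^ q) ∎
    where Y = y ^ N

  yᴺ*yᴺ*y*denPoly^q≡numPoly : ∀ {y} → μ (suc q) y → y ^ N * y ^ N * y * denPoly y ^ q ≡ numPoly y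
  yᴺ*yᴺ*y*denPoly^q≡numPoly {y} y∈μ = begin
    Y * Y * y * denPoly y ^ q                        ≡⟨ cong (Y * Y * y *_) (denPoly^q y) ⟩
    Y * Y * y * (w + γ ^ q * (w * w + y ^ q))
      ≡⟨ solve 5 (λ Y y w g v → (Y :* Y :* y :* (w :+ g :* (w :* w :+ v)))
                              := (w :* Y :* Y :* y :+ g :* ((w :* Y) :* (w :* Y) :* y :+ Y :* Y :* (y :* v))))
               refl Y y w (γ ^ q) (y ^ q) ⟩
    w * Y * Y * y + γ ^ q * (w * Y * (w * Y) * y + Y * Y * (y * y ^ q))
      ≡⟨ cong₂ (λ a b → a * Y * y + γ ^ q * (a * a * y + Y * Y * b)) ([yᴺ]^q*yᴺ≡1 y∈μ) y∈μ ⟩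
    1# * Y * y + γ ^ q * (1# * 1# * y + Y * Y * 1#)
      ≡⟨ cong₂ (λ a b → a * y + γ ^ q * (b + Y * Y * 1#)) (*-identityˡ Y) (trans (cong (_* y) (*-identityˡ 1#)) (*-identityˡ y)) ⟩
    Y * y + γ ^ q * (y + Y * Y * 1#)                 ≡⟨ cong (λ z → Y * y + γ ^ q * (y + z)) (*-identityʳ (Y * Y)) ⟩
    numPoly y                                        ∎
    where Y = y ^ N
          w = Y ^ q

  yᴺ*F^q≡x*numPoly : ∀ {x} → x ≢ 0# → (x ^ (q ∸ 1)) ^ N * F x ^ q ≡ x * numPoly (x ^ (q ∸ 1))
  yᴺ*F^q≡x*numPoly {x} x≢0 = begin
    Y * F x ^ q                     ≡⟨ *-identityˡ _ ⟨
    1# * (Y * F x ^ q)              ≡⟨ cong (_* (Y * F x ^ q)) ([yᴺ]^q*yᴺ≡1 (x^[q-1]∈μ x≢0)) ⟨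
    Y ^ q * Y * (Y * F x ^ q)       ≡⟨ solve 3 (λ w Y f → w :* Y :* (Y :* f) := Y :* Y :* (w :* f)) refl (Y ^ q) Y (F x ^ q) ⟩
    Y * Y * (Y ^ q * F x ^ q)       ≡⟨ cong (Y * Y *_) (^-distrib-* Y (F x) q) ⟨
    Y * Y * (Y * F x) ^ q           ≡⟨ cong (λ z → Y * Y * z ^ q) (yᴺ*F≡x*denPoly x≢0) ⟩
    Y * Y * (x * denPoly y) ^ q     ≡⟨ cong (Y * Y *_) (^-distrib-* x (denPoly y) q) ⟩
    Y * Y * (x * y * denPoly y ^ q) ≡⟨ solve 4 (λ Y x y d → Y :* Y :* (x :* y :* d) := x :* (Y :* Y :* y :* d)) refl Y x y (denPoly y ^ q) ⟩
    x * (Y * Y * y * denPoly y ^ q) ≡⟨ cong (x *_) (yᴺ*yᴺ*y*denPoly^q≡numPoly (x^[q-1]∈μ x≢0)) ⟩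
    x * numPoly y                   ∎
    where y = x ^ (q ∸ 1)
          Y = y ^ N

  H*denPoly≡numPoly : ∀ {y} → y ≢ 0# → den y ≢ 0# → H y * denPoly y ≡ numPoly y
  H*denPoly≡numPoly {y} y≢0 den≢0 = begin
    H y * denPoly y     ≡⟨ cong (H y *_) (y*den≡denPoly y≢0) ⟨
    H y * (y * den y)   ≡⟨ solve 3 (λ h y d → h :* (y :* d) := y :* (h :* d)) refl (H y) y (den y) ⟩
    y * (H y * den y)   ≡⟨ cong (y *_) (x*y⁻¹*y≡x (num y) den≢0) ⟩
    y * num y           ≡⟨ y*num≡numPoly y≢0 ⟩
    numPoly y           ∎

  den≡0⇒F≡0 : ∀ {x} → x ≢ 0# → den (x ^ (q ∸ 1)) ≡ 0# → F x ≡ 0#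
  den≡0⇒F≡0 {x} x≢0 den≡0 = *-cancelˡ (x^n≢0 N (x^n≢0 (q ∸ 1) x≢0)) (begin
    Y * F x             ≡⟨ yᴺ*F≡x*denPoly x≢0 ⟩
    x * denPoly y       ≡⟨ cong (x *_) (y*den≡denPoly (x^n≢0 (q ∸ 1) x≢0)) ⟨
    x * (y * den y)     ≡⟨ cong (λ z → x * (y * z)) den≡0 ⟩
    x * (y * 0#)        ≡⟨ trans (cong (x *_) (zeroʳ y)) (zeroʳ x) ⟩
    0#                  ≡⟨ zeroʳ Y ⟨
    Y * 0#              ∎)
    where y = x ^ (q ∸ 1)
          Y = y ^ N

  den≢0⇒F≢0 : ∀ {x} → x ≢ 0# → den (x ^ (q ∸ 1)) ≢ 0# → F x ≢ 0#
  den≢0⇒F≢0 {x} x≢0 den≢0 F≡0 = x*y≢0 x≢0 (x*y≢0 (x^n≢0 (q ∸ 1) x≢0) den≢0) (begin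
    x * (y * den y)     ≡⟨ cong (x *_) (y*den≡denPoly (x^n≢0 (q ∸ 1) x≢0)) ⟩
    x * denPoly y       ≡⟨ yᴺ*F≡x*denPoly x≢0 ⟨
    y ^ N * F x         ≡⟨ cong (y ^ N *_) F≡0 ⟩
    y ^ N * 0#          ≡⟨ zeroʳ (y ^ N) ⟩
    0#                  ∎)
    where y = x ^ (q ∸ 1)

  H[x^[q-1]]≡F[x]^[q-1] : ∀ {x} → x ≢ 0# → den (x ^ (q ∸ 1)) ≢ 0# → H (x ^ (q ∸ 1)) ≡ F x ^ (q ∸ 1)
  H[x^[q-1]]≡F[x]^[q-1] {x} x≢0 den≢0 = *-cancelˡ (den≢0⇒F≢0 x≢0 den≢0) (trans (*-comm (F x) (H y))
    (*-cancelˡ (x^n≢0 N (x^n≢0 (q ∸ 1) x≢0)) (begin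
      Y * (H y * F x)     ≡⟨ solve 3 (λ Y h f → Y :* (h :* f) := h :* (Y :* f)) refl Y (H y) (F x) ⟩
      H y * (Y * F x)     ≡⟨ cong (H y *_) (yᴺ*F≡x*denPoly x≢0) ⟩
      H y * (x * denPoly y) ≡⟨ solve 3 (λ h x d → h :* (x :* d) := x :* (h :* d)) refl (H y) x (denPoly y) ⟩
      x * (H y * denPoly y) ≡⟨ cong (x *_) (H*denPoly≡numPoly (x^n≢0 (q ∸ 1) x≢0) den≢0) ⟩
      x * numPoly y       ≡⟨ yᴺ*F^q≡x*numPoly x≢0 ⟨
      Y * F x ^ q         ∎)))
    where y = x ^ (q ∸ 1)
          Y = y ^ N

  c^q≡c⇒c^k≡c : ∀ {c} → c ^ q ≡ c → c ^ k ≡ c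
  c^q≡c⇒c^k≡c {c} c^q≡c = trans (x^k≡[x^[q-1]]^N*x c) (go N)
    where
    go : ∀ n → (c ^ (q ∸ 1)) ^ n * c ≡ c
    go zero    = *-identityˡ c
    go (suc n) = begin
      c ^ (q ∸ 1) * (c ^ (q ∸ 1)) ^ n * c   ≡⟨ *-assoc (c ^ (q ∸ 1)) _ c ⟩
      c ^ (q ∸ 1) * ((c ^ (q ∸ 1)) ^ n * c) ≡⟨ cong (c ^ (q ∸ 1) *_) (go n) ⟩
      c ^ (q ∸ 1) * c                       ≡⟨ *-comm (c ^ (q ∸ 1)) c ⟩
      c ^ q                                 ≡⟨ c^q≡c ⟩
      c                                     ∎

  F[c*x]≡c*F[x] : ∀ {c} x → c ^ q ≡ c → F (c * x) ≡ c * F x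
  F[c*x]≡c*F[x] {c} x c^q≡c = begin
    c * x + γ * (((c * x) ^ k) ^ q + (c * x) ^ k) ≡⟨ cong (λ z → c * x + γ * (z ^ q + z)) [cx]^k≡c*x^k ⟩
    c * x + γ * ((c * x ^ k) ^ q + c * x ^ k)     ≡⟨ cong (λ z → c * x + γ * (z + c * x ^ k)) (^-distrib-* c (x ^ k) q) ⟩
    c * x + γ * (c ^ q * (x ^ k) ^ q + c * x ^ k) ≡⟨ cong (λ z → c * x + γ * (z * (x ^ k) ^ q + c * x ^ k)) c^q≡c ⟩
    c * x + γ * (c * (x ^ k) ^ q + c * x ^ k)
      ≡⟨ solve 5 (λ c x g Z X → c :* x :+ g :* (c :* Z :+ c :* X) := c :* (x :+ g :* (Z :+ X))) refl c x γ ((x ^ k) ^ q) (x ^ k) ⟩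
    c * F x                                       ∎
    where [cx]^k≡c*x^k : (c * x) ^ k ≡ c * x ^ k
          [cx]^k≡c*x^k = trans (^-distrib-* c x k) (cong (_* x ^ k) (c^q≡c⇒c^k≡c c^q≡c))

  NoPoles : Set
  NoPoles = ∀ y → μ (suc q) y → den y ≢ 0#

  F-injective⇒noPoles : Injective _≡_ _≡_ F → NoPoles
  F-injective⇒noPoles F-inj y y∈μ den≡0 with hilbert90 y∈μ
  ... | x , x≢0 , refl = x≢0 (F-inj (trans (den≡0⇒F≡0 x≢0 den≡0) (sym F-0)))

  H-maps : NoPoles → ∀ y → μ (suc q) y → μ (suc q) (H y)
  H-maps noPoles y y∈μ with hilbert90 y∈μ
  ... | x , x≢0 , refl = subst (μ (suc q)) (sym (H[x^[q-1]]≡F[x]^[q-1] x≢0 (noPoles _ y∈μ)))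
                               (x^[q-1]∈μ (den≢0⇒F≢0 x≢0 (noPoles _ y∈μ)))

  H-injective : Injective _≡_ _≡_ F → InjectiveOn (μ (suc q)) H
  H-injective F-inj y₁ y₂ y₁∈μ y₂∈μ H[y₁]≡H[y₂] with hilbert90 y₁∈μ | hilbert90 y₂∈μ
  ... | x₁ , x₁≢0 , refl | x₂ , x₂≢0 , refl = begin
    x₁ ^ (q ∸ 1)                ≡⟨ cong (_^ (q ∸ 1)) c*x₂≡x₁ ⟨
    (c * x₂) ^ (q ∸ 1)          ≡⟨ ^-distrib-* c x₂ (q ∸ 1) ⟩
    c ^ (q ∸ 1) * x₂ ^ (q ∸ 1)  ≡⟨ cong (_* x₂ ^ (q ∸ 1)) c^[q-1]≡1 ⟩
    1# * x₂ ^ (q ∸ 1)           ≡⟨ *-identityˡ _ ⟩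
    x₂ ^ (q ∸ 1)                ∎
    where
    noPoles = F-injective⇒noPoles F-inj
    F₂≢0 = den≢0⇒F≢0 x₂≢0 (noPoles _ y₂∈μ)
    F₁^[q-1]≡F₂^[q-1] : F x₁ ^ (q ∸ 1) ≡ F x₂ ^ (q ∸ 1)
    F₁^[q-1]≡F₂^[q-1] = begin
      F x₁ ^ (q ∸ 1)          ≡⟨ H[x^[q-1]]≡F[x]^[q-1] x₁≢0 (noPoles _ y₁∈μ) ⟨
      H (x₁ ^ (q ∸ 1))        ≡⟨ H[y₁]≡H[y₂] ⟩
      H (x₂ ^ (q ∸ 1))        ≡⟨ H[x^[q-1]]≡F[x]^[q-1] x₂≢0 (noPoles _ y₂∈μ) ⟩
      F x₂ ^ (q ∸ 1)          ∎
    c = F x₁ * F x₂ ⁻¹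
    c^[q-1]≡1 : c ^ (q ∸ 1) ≡ 1#
    c^[q-1]≡1 = x^n≡y^n⇒[x*y⁻¹]^n≡1 (q ∸ 1) F₂≢0 F₁^[q-1]≡F₂^[q-1]
    c*x₂≡x₁ : c * x₂ ≡ x₁
    c*x₂≡x₁ = F-inj (trans (F[c*x]≡c*F[x] x₂ (trans (cong (c *_) c^[q-1]≡1) (*-identityʳ c))) (x*y⁻¹*y≡x (F x₁) F₂≢0))

  H-surjective : Permutes F → ∀ w → μ (suc q) w → ∃ λ y → μ (suc q) y × H y ≡ w
  H-surjective (F-inj , F-surj) w w∈μ with hilbert90 w∈μ
  ... | z , z≢0 , refl = x ^ (q ∸ 1) , x^[q-1]∈μ x≢0 , (begin
    H (x ^ (q ∸ 1))   ≡⟨ H[x^[q-1]]≡F[x]^[q-1] x≢0 (F-injective⇒noPoles F-inj _ (x^[q-1]∈μ x≢0)) ⟩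
    F x ^ (q ∸ 1)     ≡⟨ cong (_^ (q ∸ 1)) F[x]≡z ⟩
    z ^ (q ∸ 1)       ∎)
    where
    x = proj₁ (F-surj z)
    F[x]≡z : F x ≡ z
    F[x]≡z = proj₂ (F-surj z) refl
    x≢0 : x ≢ 0#
    x≢0 x≡0 = z≢0 (trans (sym F[x]≡z) (trans (cong F x≡0) F-0))

  noPoles⇒F≢0 : NoPoles → ∀ {x} → x ≢ 0# → F x ≢ 0#
  noPoles⇒F≢0 noPoles x≢0 = den≢0⇒F≢0 x≢0 (noPoles _ (x^[q-1]∈μ x≢0))

  noPoles⇒denPoly≢0 : NoPoles → ∀ {x} → x ≢ 0# → denPoly (x ^ (q ∸ 1)) ≢ 0#
  noPoles⇒denPoly≢0 noPoles x≢0 D≡0 = x*y≢0 (x^n≢0 (q ∸ 1) x≢0) (noPoles _ (x^[q-1]∈μ x≢0))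
    (trans (y*den≡denPoly (x^n≢0 (q ∸ 1) x≢0)) D≡0)

  noPoles⇒H[x^[q-1]]≡F[x]^[q-1] : NoPoles → ∀ {x} → x ≢ 0# → H (x ^ (q ∸ 1)) ≡ F x ^ (q ∸ 1)
  noPoles⇒H[x^[q-1]]≡F[x]^[q-1] noPoles x≢0 = H[x^[q-1]]≡F[x]^[q-1] x≢0 (noPoles _ (x^[q-1]∈μ x≢0))

  same-[q-1]-power∧F≡⇒≡ : NoPoles → ∀ {a b} → a ≢ 0# → b ≢ 0# →
                           a ^ (q ∸ 1) ≡ b ^ (q ∸ 1) → F a ≡ F b → a ≡ b
  same-[q-1]-power∧F≡⇒≡ noPoles {a} {b} a≢0 b≢0 y≡ F[a]≡F[b] = *-cancelʳ (noPoles⇒denPoly≢0 noPoles a≢0) (begin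
    a * denPoly (a ^ (q ∸ 1))     ≡⟨ yᴺ*F≡x*denPoly a≢0 ⟨
    (a ^ (q ∸ 1)) ^ N * F a       ≡⟨ cong₂ (λ y z → y ^ N * z) y≡ F[a]≡F[b] ⟩
    (b ^ (q ∸ 1)) ^ N * F b       ≡⟨ yᴺ*F≡x*denPoly b≢0 ⟩
    b * denPoly (b ^ (q ∸ 1))     ≡⟨ cong (λ y → b * denPoly y) y≡ ⟨
    b * denPoly (a ^ (q ∸ 1))     ∎)

  noPoles∧H-injective⇒F-injective : NoPoles → InjectiveOn (μ (suc q)) H → Injective _≡_ _≡_ F
  noPoles∧H-injective⇒F-injective noPoles H-inj {a} {b} F[a]≡F[b] with a ≟ 0# | b ≟ 0#
  ... | yes a≡0  | yes b≡0 = trans a≡0 (sym b≡0)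
  ... | yes refl | no b≢0  = ⊥-elim (noPoles⇒F≢0 noPoles b≢0 (trans (sym F[a]≡F[b]) F-0))
  ... | no a≢0   | yes refl = ⊥-elim (noPoles⇒F≢0 noPoles a≢0 (trans F[a]≡F[b] F-0))
  ... | no a≢0   | no b≢0  = same-[q-1]-power∧F≡⇒≡ noPoles a≢0 b≢0
    (H-inj _ _ (x^[q-1]∈μ a≢0) (x^[q-1]∈μ b≢0) (begin
      H (a ^ (q ∸ 1))   ≡⟨ noPoles⇒H[x^[q-1]]≡F[x]^[q-1] noPoles a≢0 ⟩
      F a ^ (q ∸ 1)     ≡⟨ cong (_^ (q ∸ 1)) F[a]≡F[b] ⟩
      F b ^ (q ∸ 1)     ≡⟨ noPoles⇒H[x^[q-1]]≡F[x]^[q-1] noPoles b≢0 ⟨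
      H (b ^ (q ∸ 1))   ∎))
    F[a]≡F[b]

  F-permutes : NoPoles → InjectiveOn (μ (suc q)) H → Permutes F
  F-permutes noPoles H-inj = F-inj , injective⇒surjective F F-inj
    where F-inj = noPoles∧H-injective⇒F-injective noPoles H-inj

  theorem : (Permutes F ⇔ RationalPermutes (μ (suc q)) num den)
          × (Permutes F ⇔ RationalInjectiveNoPoles (μ (suc q)) num den)
  theorem = mk⇔ (λ F-perm@(F-inj , _) → let noPoles = F-injective⇒noPoles F-inj in
                   noPoles , H-maps noPoles , H-injective F-inj , H-surjective F-perm)
                (λ (noPoles , _ , H-inj , _) → F-permutes noPoles H-inj)
          , mk⇔ (λ (F-inj , _) → H-injective F-inj , F-injective⇒noPoles F-inj)
                (λ (H-inj , noPoles) → F-permutes noPoles H-inj)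

proposition2p4 : (q : ℕ) → IsPrimePower q → (K : FiniteFieldOfSize (q ℕ.* q)) →
    let open FiniteFieldOfSize K
        open FieldOps field′
    in (N : ℕ) → (γ : Carrier) → γ ≢ 0# →
      let k = (q ℕ.∸ 1) ℕ.* N ℕ.+ 1
          F = λ x → x + γ * ((x ^ k) ^ q + x ^ k)
          num = λ x → x ^ℤ (+ N) + (γ ^ q) * (1# + x ^ℤ (+ (2 ℕ.* N) ℤ.- + 1))
          den = λ x → x ^ℤ (+ N ℤ.- + 1) + γ * (x ^ℤ (+ (2 ℕ.* N) ℤ.- + 1) + 1#)
      in (Permutes F ⇔ RationalPermutes (μ (suc q)) num den)
         × (Permutes F ⇔ RationalInjectiveNoPoles (μ (suc q)) num den)
proposition2p4 zero _ K with size≥2 K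
... | ()
proposition2p4 (suc zero) _ K with size≥2 K
... | s≤s ()
proposition2p4 (suc (suc r)) (p , e , p-prime , _ , q≡pᵉ) K N γ _ =
  Proposition.theorem r p e p-prime q≡pᵉ K N γ
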